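{- Let $\ell\in\{1,2,3\}$, let $G$ be a $(2,\ell)$-tight simple graph with $|V(G)|>4$, and let $K$ be a copy of $K_4$ in $G$. Then the graph $G/K$ obtained by the $K_4$-to-vertex move on $K$ is simple and $(2,\ell)$-tight, unless there is a copy $T$ of $K_3$ in $G$ with $|V(T)\cap V(K)|=2$.
   Context: For a graph $H$ let $f(H)=2|V(H)|-|E(H)|$. A simple graph $G$ is $(2,\ell)$-sparse if $f(H)\ge \ell$ for every subgraph $H$ of $G$ with at least one edge, and $(2,\ell)$-tight if it is $(2,\ell)$-sparse and $f(G)=\ell$. The $K_4$-to-vertex move on a copy $K$ of $K_4$ in $G$ produces the (possibly multi)graph $G/K$ with vertex set $(V(G)\setminus V(K))\cup\{v_*\}$ and edge set $(E(G)\setminus E(K))$ with every edge $vw$ ($v\notin V(K)$, $w\in V(K)$) replaced by an edge $vv_*$ (so multiple edges may arise). -}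

module Defs where

open import Data.Nat using (ℕ; _+_; _*_; _≤_; _<_)
open import Data.Fin using (Fin)
open import Data.Fin.Properties using (_≟_; any?)
open import Data.Fin.Subset as Sub using (Subset; ∣_∣)
open import Data.List using (List; []; length; map; filter)
open import Data.List.Membership.Propositional as LMem using ()
open import Data.List.Relation.Unary.All using (All)
open import Data.List.Relation.Unary.AllPairs using (AllPairs)
open import Data.List.Relation.Binary.Sublist.Propositional using (_⊆_)
open import Data.Product using (Σ; ∃; _×_; _,_; proj₁; proj₂)
open import Data.Product.Properties using ()
open import Data.Sum using (_⊎_)
open import Relation.Nullary using (¬_; Dec)
open import Relation.Nullary.Decidable using (¬?; _×-dec_)
open import Relation.Binary.PropositionalEquality using (_≡_; _≢_)
open import Function.Definitions using (Injective)

-- Each entry (u , v) is one edge joining u and v (unordered; the order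
-- in the pair carries no meaning).  Repeated entries = parallel edges,
-- entries (v , v) = loops.
Graph : ℕ → Set
Graph n = List (Fin n × Fin n)

SameEnds : ∀ {n} → (Fin n × Fin n) → (Fin n × Fin n) → Set
SameEnds (u , v) (x , y) = (u ≡ x × v ≡ y) ⊎ (u ≡ y × v ≡ x)

Simple : ∀ {n} → Graph n → Set
Simple G = All (λ e → proj₁ e ≢ proj₂ e) G × AllPairs (λ e e' → ¬ SameEnds e e') G

Adj : ∀ {n} → Graph n → Fin n → Fin n → Set
Adj G u v = ((u , v) LMem.∈ G) ⊎ ((v , u) LMem.∈ G)

EdgeIn : ∀ {n} → Subset n → (Fin n × Fin n) → Set
EdgeIn S (u , v) = (u Sub.∈ S) × (v Sub.∈ S)

-- A subgraph H = (S , F) of G: vertex set S ⊆ V(G), edge (multi)set F a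
-- sublist of E(G) with all endpoints in S.
-- (2,ℓ)-sparse: f(H) = 2|S| - |F| ≥ ℓ for every subgraph with ≥ 1 edge,
-- written without subtraction as |F| + ℓ ≤ 2|S|.
Sparse : ∀ {n} → ℕ → Graph n → Set
Sparse {n} ℓ G = (S : Subset n) (F : Graph n) → F ⊆ G → All (EdgeIn S) F →
                 F ≢ [] → length F + ℓ ≤ 2 * ∣ S ∣

Tight : ∀ {n} → ℕ → Graph n → Set
Tight {n} ℓ G = Sparse ℓ G × (length G + ℓ ≡ 2 * n)

IsK4 : ∀ {n} → Graph n → (Fin 4 → Fin n) → Set
IsK4 G k = Injective _≡_ _≡_ k × (∀ i j → i ≢ j → Adj G (k i) (k j))

InK : ∀ {n} → (Fin 4 → Fin n) → Fin n → Set
InK k v = ∃ λ i → k i ≡ v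

InK? : ∀ {n} (k : Fin 4 → Fin n) (v : Fin n) → Dec (InK k v)
InK? k v = any? (λ i → k i ≟ v)

-- φ : Fin n → Fin m is a quotient map identifying exactly the vertices of K
-- to a single new vertex v_* : it is surjective, constant on V(K), and
-- injective on V(G) ∖ V(K) with images different from φ(V(K)).
-- Hence Fin m ≅ (V(G) ∖ V(K)) ∪ {v_*} via φ.
IsK4Quotient : ∀ {n m} → (Fin 4 → Fin n) → (Fin n → Fin m) → Set
IsK4Quotient {n} {m} k φ =
  (∀ y → ∃ λ x → φ x ≡ y) ×
  (∀ i j → φ (k i) ≡ φ (k j)) ×
  (∀ (u v : Fin n) → ¬ InK k u → φ u ≡ φ v → u ≡ v)

-- E(G) ∖ E(K): edges not having both endpoints in V(K)
-- (in a simple graph these are exactly the edges not in the copy K of K4)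
NotKEdge? : ∀ {n} (k : Fin 4 → Fin n) (e : Fin n × Fin n) →
            Dec (¬ (InK k (proj₁ e) × InK k (proj₂ e)))
NotKEdge? k (u , v) = ¬? (InK? k u ×-dec InK? k v)

contractK4 : ∀ {n m} → Graph n → (Fin 4 → Fin n) → (Fin n → Fin m) → Graph m
contractK4 G k φ = map (λ e → φ (proj₁ e) , φ (proj₂ e)) (filter (NotKEdge? k) G)

TriangleMeetingK2 : ∀ {n} → Graph n → (Fin 4 → Fin n) → Set
TriangleMeetingK2 {n} G k =
  Σ (Fin n) λ x → Σ (Fin n) λ y → Σ (Fin n) λ z →
    InK k x × InK k y × ¬ InK k z × x ≢ y ×
    Adj G x y × Adj G x z × Adj G y z

module Submission where

-- Let K be the copy of K4, v* the vertex it is contracted to, and C the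
-- edges of G not lying inside K (outerEdges), so that the edges of G/K are
-- the images of C under φ.
--
-- (1) Counting vertices.  The quotient map φ has a fibre of size 4 over v*
--     and of size 1 elsewhere; by double counting, a vertex set S' of G/K has
--     a preimage of size ∣S'∣ + 3·[v* ∈ S'].  In particular n = m + 3.
-- (2) Counting edges.  Since G is simple, the edges inside K correspond
--     bijectively to the six 2-subsets of Fin 4, so there are exactly six.
-- (3) No collapsing.  A vertex outside K has at most one neighbour in K (a
--     second one would give a forbidden triangle), hence φ is injective on C:
--     G/K has no loops and no parallel edges.
-- (4) Sparsity.  A subgraph of G/K lifts to a subgraph of G with the same
--     value of f = 2|V| - |E|: take the preimage of its vertex set and, if v*
--     is among them, add the six edges of K.  Tightness then follows from
--     |E(G/K)| = |E(G)| - 6 and n = m + 3.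

open import Defs
open import Data.Nat using (ℕ; zero; suc; _≤_; _<_; _+_; _*_)
open import Data.Nat.Properties using (+-*-semiring; *-identityˡ; *-identityʳ; *-zeroʳ;
  +-suc; +-identityʳ; +-monoʳ-≤; +-cancelˡ-≤; +-cancelʳ-≡; ≤-antisym; 0≢1+n; module ≤-Reasoning)
open import Data.Nat.Tactic.RingSolver using (solve-∀)
open import Algebra.Properties.Semiring.Sum +-*-semiring
  using (sum; sum-syntax; ∑-comm; ∑-distrib-+; sum-cong-≗; *-distribˡ-sum; sum-replicate-zero)
open import Data.Bool using (Bool; true; false)
open import Data.Fin using (Fin; zero; suc)
open import Data.Fin.Patterns using (0F; 1F; 2F; 3F; 4F; 5F)
open import Data.Fin.Properties using (_≟_; any?; injective⇒≤)
open import Data.Fin.Subset as Subset using (Subset; ∣_∣)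
open import Data.Vec using ([]; _∷_; lookup; tabulate)
open import Data.Vec.Properties using (lookup∘tabulate; []=⇒lookup; lookup⇒[]=)
open import Data.Product using (∃; _×_; _,_; proj₁; proj₂)
open import Data.Sum using (_⊎_; inj₁; inj₂)
open import Data.Empty using (⊥-elim)
open import Relation.Nullary using (¬_; Dec; yes; no; does)
open import Relation.Nullary.Decidable using (¬?; _×-dec_)
open import Relation.Unary using (Pred; Decidable)
open import Relation.Binary.PropositionalEquality
open import Function.Definitions using (Injective)
open import Data.List using (List; []; _∷_; length; map; filter)
import Data.List as List
open import Data.List.Properties using (length-map)
open import Data.List.Relation.Unary.All as All using (All; []; _∷_)
import Data.List.Relation.Unary.All.Properties as AllP
open import Data.List.Relation.Unary.Any as Any using ()
open import Data.List.Relation.Unary.Any.Properties using (lookup-index)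
open import Data.List.Relation.Unary.AllPairs using (AllPairs; []; _∷_)
import Data.List.Relation.Unary.AllPairs.Properties as AllPairsP
open import Data.List.Relation.Binary.Sublist.Propositional using (_⊆_; []; _∷_; _∷ʳ_; ⊆-trans)
open import Data.List.Relation.Binary.Sublist.Propositional.Properties using (filter-⊆)
open import Data.List.Membership.Propositional using (_∈_)
open import Data.List.Membership.Propositional.Properties using (∈-filter⁺; ∈-filter⁻; ∈-lookup)

-- Indicators and finite sums over Fin

𝟙 : Bool → ℕ
𝟙 true = 1
𝟙 false = 0

δ : ∀ {n} → Fin n → Fin n → ℕ
δ x y = 𝟙 (does (x ≟ y))

𝟙-cong : ∀ {p q} {P : Set p} {Q : Set q} → (P → Q) → (Q → P) →
         (P? : Dec P) (Q? : Dec Q) → 𝟙 (does P?) ≡ 𝟙 (does Q?)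
𝟙-cong to from (yes _) (yes _) = refl
𝟙-cong to from (no _) (no _) = refl
𝟙-cong to from (yes p) (no ¬q) = ⊥-elim (¬q (to p))
𝟙-cong to from (no ¬p) (yes q) = ⊥-elim (¬p (from q))

δ-diag : ∀ {n} (x : Fin n) → δ x x ≡ 1
δ-diag x with x ≟ x
... | yes _ = refl
... | no x≢x = ⊥-elim (x≢x refl)

δ-off : ∀ {n} {x y : Fin n} → x ≢ y → δ x y ≡ 0
δ-off {x = x} {y} x≢y with x ≟ y
... | yes x≡y = ⊥-elim (x≢y x≡y)
... | no _ = refl

∑-δ : ∀ {n} (h : Fin n → ℕ) (c : Fin n) → ∑[ y < n ] (h y * δ c y) ≡ h c
∑-δ {suc n} h 0F = begin
  h 0F * 1 + ∑[ y < n ] (h (suc y) * 0)  ≡⟨ cong₂ _+_ (*-identityʳ (h 0F)) (sum-cong-≗ (λ y → *-zeroʳ (h (suc y)))) ⟩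
  h 0F + ∑[ y < n ] 0                    ≡⟨ cong (h 0F +_) (sum-replicate-zero n) ⟩
  h 0F + 0                               ≡⟨ +-identityʳ (h 0F) ⟩
  h 0F                                   ∎
  where open ≡-Reasoning
∑-δ {suc n} h (suc c) = trans (cong (_+ ∑[ y < n ] (h (suc y) * δ c y)) (*-zeroʳ (h 0F))) (∑-δ {n} (λ y → h (suc y)) c)

∑-fibres : ∀ {n m} (f : Fin n → Fin m) (h : Fin m → ℕ) →
           ∑[ x < n ] h (f x) ≡ ∑[ y < m ] (h y * ∑[ x < n ] δ (f x) y)
∑-fibres {n} {m} f h = begin
  ∑[ x < n ] h (f x)                        ≡⟨ sum-cong-≗ (λ x → sym (∑-δ h (f x))) ⟩
  ∑[ x < n ] ∑[ y < m ] (h y * δ (f x) y)   ≡⟨ ∑-comm (λ x y → h y * δ (f x) y) ⟩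
  ∑[ y < m ] ∑[ x < n ] (h y * δ (f x) y)   ≡⟨ sum-cong-≗ (λ y → sym (*-distribˡ-sum (h y) (λ x → δ (f x) y))) ⟩
  ∑[ y < m ] (h y * ∑[ x < n ] δ (f x) y)   ∎
  where open ≡-Reasoning

injective-fibre : ∀ {a n} {f : Fin a → Fin n} → Injective _≡_ _≡_ f →
                  ∀ x → ∑[ i < a ] δ (f i) x ≡ 𝟙 (does (any? (λ i → f i ≟ x)))
injective-fibre {a} {f = f} f-inj x with any? (λ i → f i ≟ x)
... | yes (i₀ , fi₀≡x) = trans (sum-cong-≗ same-δ) (∑-δ (λ _ → 1) i₀)
  where
  same-δ : ∀ i → δ (f i) x ≡ 1 * δ i₀ i
  same-δ i = trans (𝟙-cong (λ e → f-inj (trans fi₀≡x (sym e))) (λ e → trans (cong f (sym e)) fi₀≡x)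
                           (f i ≟ x) (i₀ ≟ i))
                   (sym (*-identityˡ _))
... | no x∉img = trans (sum-cong-≗ (λ i → δ-off (λ e → x∉img (i , e))))
                      (sum-replicate-zero a)

∣∣≡∑ : ∀ {n} (S : Subset n) → ∣ S ∣ ≡ ∑[ x < n ] 𝟙 (lookup S x)
∣∣≡∑ [] = refl
∣∣≡∑ (true ∷ S) = cong suc (∣∣≡∑ S)
∣∣≡∑ (false ∷ S) = ∣∣≡∑ S

∑-one : ∀ n → ∑[ x < n ] 1 ≡ n
∑-one zero = refl
∑-one (suc n) = cong suc (∑-one n)

-- Lists: sublists, filters and counting by codes

module _ {a} {A : Set a} where

  length-filter-split : ∀ {p} {P : Pred A p} (P? : Decidable P) (xs : List A) →
    length (filter (λ x → ¬? (P? x)) xs) + length (filter P? xs) ≡ length xs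
  length-filter-split P? [] = refl
  length-filter-split P? (x ∷ xs) with P? x
  ... | yes _ = trans (+-suc _ _) (cong suc (length-filter-split P? xs))
  ... | no _ = cong suc (length-filter-split P? xs)

  ⊆-union-filter : ∀ {p r} {P : Pred A p} {R : Pred A r} (P? : Decidable P) (xs : List A) {ys : List A} →
    ys ⊆ filter (λ x → ¬? (P? x)) xs → All R ys → All R (filter P? xs) →
    ∃ λ zs → zs ⊆ xs × length zs ≡ length ys + length (filter P? xs) × All R zs
  ⊆-union-filter P? [] [] _ _ = [] , [] , refl , []
  ⊆-union-filter P? (x ∷ xs) ys⊆ Rys Rps with P? x
  ... | yes _ with ⊆-union-filter P? xs ys⊆ Rys (All.tail Rps)
  ...   | zs , zs⊆ , len , Rzs = x ∷ zs , refl ∷ zs⊆ , trans (cong suc len) (sym (+-suc _ _)) , All.head Rps ∷ Rzs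
  ⊆-union-filter P? (x ∷ xs) (_ ∷ʳ ys⊆) Rys Rps | no _ with ⊆-union-filter P? xs ys⊆ Rys Rps
  ...   | zs , zs⊆ , len , Rzs = zs , x ∷ʳ zs⊆ , len , Rzs
  ⊆-union-filter P? (x ∷ xs) (refl ∷ ys⊆) (Rx ∷ Rys) Rps | no _ with ⊆-union-filter P? xs ys⊆ Rys Rps
  ...   | zs , zs⊆ , len , Rzs = x ∷ zs , refl ∷ zs⊆ , cong suc len , Rx ∷ Rzs

  ⊆-map⁻ : ∀ {b} {B : Set b} (f : A → B) {zs : List B} (xs : List A) →
    zs ⊆ map f xs → ∃ λ ys → ys ⊆ xs × map f ys ≡ zs
  ⊆-map⁻ f [] [] = [] , [] , refl
  ⊆-map⁻ f (x ∷ xs) (_ ∷ʳ zs⊆) with ⊆-map⁻ f xs zs⊆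
  ... | ys , ys⊆ , eq = ys , x ∷ʳ ys⊆ , eq
  ⊆-map⁻ f (x ∷ xs) (refl ∷ zs⊆) with ⊆-map⁻ f xs zs⊆
  ... | ys , ys⊆ , eq = x ∷ ys , refl ∷ ys⊆ , cong (f x ∷_) eq

  AllPairs-mapWith : ∀ {p r s} {P : Pred A p} {R : A → A → Set r} {S : A → A → Set s} →
    (∀ {x y} → P x → P y → R x y → S x y) → ∀ {xs} → All P xs → AllPairs R xs → AllPairs S xs
  AllPairs-mapWith h [] [] = []
  AllPairs-mapWith h (px ∷ pxs) (Rx ∷ Rxs) =
    All.zipWith (λ (py , r) → h px py r) (pxs , Rx) ∷ AllPairs-mapWith h pxs Rxs

  AllPairs-lookup : ∀ {r} {R : A → A → Set r} {xs : List A} → AllPairs R xs →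
    (i j : Fin (length xs)) → i ≢ j →
    R (List.lookup xs i) (List.lookup xs j) ⊎ R (List.lookup xs j) (List.lookup xs i)
  AllPairs-lookup (Rx ∷ Rxs) zero zero i≢j = ⊥-elim (i≢j refl)
  AllPairs-lookup (Rx ∷ Rxs) zero (suc j) _ = inj₁ (All.lookup Rx (∈-lookup j))
  AllPairs-lookup (Rx ∷ Rxs) (suc i) zero _ = inj₂ (All.lookup Rx (∈-lookup i))
  AllPairs-lookup (Rx ∷ Rxs) (suc i) (suc j) i≢j = AllPairs-lookup Rxs i j (λ e → i≢j (cong suc e))

  length≤-by-code : ∀ {r c} {R : A → A → Set r} {xs : List A} (code : A → Fin c) →
    (∀ {x y} → x ∈ xs → y ∈ xs → code x ≡ code y → ¬ R x y) → AllPairs R xs → length xs ≤ c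
  length≤-by-code {xs = xs} code separates Rxs = injective⇒≤ code∘lookup-injective
    where
    code∘lookup-injective : Injective _≡_ _≡_ (λ i → code (List.lookup xs i))
    code∘lookup-injective {i} {j} eq with i ≟ j
    ... | yes i≡j = i≡j
    ... | no i≢j with AllPairs-lookup Rxs i j i≢j
    ...   | inj₁ Rij = ⊥-elim (separates (∈-lookup i) (∈-lookup j) eq Rij)
    ...   | inj₂ Rji = ⊥-elim (separates (∈-lookup j) (∈-lookup i) (sym eq) Rji)

  length≥-by-code : ∀ {c} {xs : List A} (code : A → Fin c) →
    (∀ i → ∃ λ x → x ∈ xs × code x ≡ i) → c ≤ length xs
  length≥-by-code {xs = xs} code attained = injective⇒≤ position-injective
    where
    position : Fin _ → Fin (length xs)
    position i = Any.index (proj₁ (proj₂ (attained i)))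
    code-position : ∀ i → code (List.lookup xs (position i)) ≡ i
    code-position i = trans (cong code (sym (lookup-index (proj₁ (proj₂ (attained i))))))
                            (proj₂ (proj₂ (attained i)))
    position-injective : Injective _≡_ _≡_ position
    position-injective {i} {j} eq =
      trans (sym (code-position i)) (trans (cong (λ p → code (List.lookup xs p)) eq) (code-position j))

SameEnds-sym : ∀ {n} {e e' : Fin n × Fin n} → SameEnds e e' → SameEnds e' e
SameEnds-sym (inj₁ (refl , refl)) = inj₁ (refl , refl)
SameEnds-sym (inj₂ (refl , refl)) = inj₂ (refl , refl)

SameEnds-trans : ∀ {n} {e e' e'' : Fin n × Fin n} → SameEnds e e' → SameEnds e' e'' → SameEnds e e''
SameEnds-trans (inj₁ (refl , refl)) s = s
SameEnds-trans (inj₂ (refl , refl)) (inj₁ (refl , refl)) = inj₂ (refl , refl)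
SameEnds-trans (inj₂ (refl , refl)) (inj₂ (refl , refl)) = inj₁ (refl , refl)

SameEnds-map : ∀ {p q} (f : Fin p → Fin q) {a b c d u v u' v'} →
  f a ≡ u → f b ≡ v → f c ≡ u' → f d ≡ v' →
  SameEnds (a , b) (c , d) → SameEnds (u , v) (u' , v')
SameEnds-map f refl refl refl refl (inj₁ (refl , refl)) = inj₁ (refl , refl)
SameEnds-map f refl refl refl refl (inj₂ (refl , refl)) = inj₂ (refl , refl)

Adj-sym : ∀ {n} {G : Graph n} {x y} → Adj G x y → Adj G y x
Adj-sym (inj₁ xy) = inj₂ xy
Adj-sym (inj₂ yx) = inj₁ yx

pair : Fin 6 → Fin 4 × Fin 4
pair 0F = 0F , 1F
pair 1F = 0F , 2F
pair 2F = 0F , 3F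
pair 3F = 1F , 2F
pair 4F = 1F , 3F
pair 5F = 2F , 3F

-- The index of the 2-subset {a , b}; the value on the diagonal is irrelevant.
pairIndex : Fin 4 → Fin 4 → Fin 6
pairIndex 0F 1F = 0F
pairIndex 0F 2F = 1F
pairIndex 0F 3F = 2F
pairIndex 1F 2F = 3F
pairIndex 1F 3F = 4F
pairIndex 2F 3F = 5F
pairIndex 1F 0F = 0F
pairIndex 2F 0F = 1F
pairIndex 3F 0F = 2F
pairIndex 2F 1F = 3F
pairIndex 3F 1F = 4F
pairIndex 3F 2F = 5F
pairIndex _ _ = 0F

pair-distinct : ∀ c → proj₁ (pair c) ≢ proj₂ (pair c)
pair-distinct 0F ()
pair-distinct 1F ()
pair-distinct 2F ()
pair-distinct 3F ()
pair-distinct 4F ()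
pair-distinct 5F ()

pairIndex-pair : ∀ {a b} c → SameEnds (a , b) (pair c) → pairIndex a b ≡ c
pairIndex-pair 0F (inj₁ (refl , refl)) = refl
pairIndex-pair 1F (inj₁ (refl , refl)) = refl
pairIndex-pair 2F (inj₁ (refl , refl)) = refl
pairIndex-pair 3F (inj₁ (refl , refl)) = refl
pairIndex-pair 4F (inj₁ (refl , refl)) = refl
pairIndex-pair 5F (inj₁ (refl , refl)) = refl
pairIndex-pair 0F (inj₂ (refl , refl)) = refl
pairIndex-pair 1F (inj₂ (refl , refl)) = refl
pairIndex-pair 2F (inj₂ (refl , refl)) = refl
pairIndex-pair 3F (inj₂ (refl , refl)) = refl
pairIndex-pair 4F (inj₂ (refl , refl)) = refl
pairIndex-pair 5F (inj₂ (refl , refl)) = refl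

pair-pairIndex : ∀ a b → a ≢ b → SameEnds (a , b) (pair (pairIndex a b))
pair-pairIndex 0F 0F a≢b = ⊥-elim (a≢b refl)
pair-pairIndex 1F 1F a≢b = ⊥-elim (a≢b refl)
pair-pairIndex 2F 2F a≢b = ⊥-elim (a≢b refl)
pair-pairIndex 3F 3F a≢b = ⊥-elim (a≢b refl)
pair-pairIndex 0F 1F _ = inj₁ (refl , refl)
pair-pairIndex 0F 2F _ = inj₁ (refl , refl)
pair-pairIndex 0F 3F _ = inj₁ (refl , refl)
pair-pairIndex 1F 2F _ = inj₁ (refl , refl)
pair-pairIndex 1F 3F _ = inj₁ (refl , refl)
pair-pairIndex 2F 3F _ = inj₁ (refl , refl)
pair-pairIndex 1F 0F _ = inj₂ (refl , refl)
pair-pairIndex 2F 0F _ = inj₂ (refl , refl)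
pair-pairIndex 3F 0F _ = inj₂ (refl , refl)
pair-pairIndex 2F 1F _ = inj₂ (refl , refl)
pair-pairIndex 3F 1F _ = inj₂ (refl , refl)
pair-pairIndex 3F 2F _ = inj₂ (refl , refl)

-- Counting vertices: φ has a fibre of size 4 over v* and 1 elsewhere

module VertexCount {n m} (k : Fin 4 → Fin n) (φ : Fin n → Fin m)
                   (k-injective : Injective _≡_ _≡_ k) (quotient : IsK4Quotient k φ) where

  v* : Fin m
  v* = φ (k 0F)

  φ-on-K : ∀ {x} → InK k x → φ x ≡ v*
  φ-on-K (i , refl) = proj₁ (proj₂ quotient) i 0F

  φ-injective-off-K : ∀ x y → ¬ InK k x → φ x ≡ φ y → x ≡ y
  φ-injective-off-K = proj₂ (proj₂ quotient)

  φ-identifies : ∀ {x y} → φ x ≡ φ y → x ≡ y ⊎ (InK k x × InK k y)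
  φ-identifies {x} {y} φx≡φy with InK? k x | InK? k y
  ... | no x∉K | _ = inj₁ (φ-injective-off-K x y x∉K φx≡φy)
  ... | yes _ | no y∉K = inj₁ (sym (φ-injective-off-K y x y∉K (sym φx≡φy)))
  ... | yes x∈K | yes y∈K = inj₂ (x∈K , y∈K)

  ∑-InK : ∑[ x < n ] 𝟙 (does (InK? k x)) ≡ 4
  ∑-InK = begin
    ∑[ x < n ] 𝟙 (does (InK? k x))          ≡⟨ sum-cong-≗ (λ x → sym (trans (*-identityˡ _) (injective-fibre k-injective x))) ⟩
    ∑[ x < n ] (1 * ∑[ i < 4 ] δ (k i) x)   ≡⟨ sym (∑-fibres k (λ _ → 1)) ⟩
    4                                       ∎
    where open ≡-Reasoning

  fibre-size : ∀ y → ∑[ x < n ] δ (φ x) y ≡ 1 + 3 * δ v* y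
  fibre-size y with y ≟ v*
  ... | yes refl = trans (sum-cong-≗ δ-v*) (trans ∑-InK (cong (λ d → 1 + 3 * d) (sym (δ-diag v*))))
    where
    InK-of-φ : ∀ {x} → φ x ≡ v* → InK k x
    InK-of-φ φx≡v* with φ-identifies φx≡v*
    ... | inj₁ refl = 0F , refl
    ... | inj₂ (x∈K , _) = x∈K
    δ-v* : ∀ x → δ (φ x) v* ≡ 𝟙 (does (InK? k x))
    δ-v* x = 𝟙-cong InK-of-φ φ-on-K (φ x ≟ v*) (InK? k x)
  ... | no y≢v* with proj₁ quotient y
  ...   | x₀ , φx₀≡y = trans (sum-cong-≗ δ-y) (trans (∑-δ (λ _ → 1) x₀) (cong (λ d → 1 + 3 * d) (sym (δ-off (λ e → y≢v* (sym e))))))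
    where
    x₀∉K : ¬ InK k x₀
    x₀∉K x₀∈K = y≢v* (trans (sym φx₀≡y) (φ-on-K x₀∈K))
    δ-y : ∀ x → δ (φ x) y ≡ 1 * δ x₀ x
    δ-y x = trans (𝟙-cong (λ e → φ-injective-off-K x₀ x x₀∉K (trans φx₀≡y (sym e)))
                          (λ e → trans (cong φ (sym e)) φx₀≡y) (φ x ≟ y) (x₀ ≟ x))
                  (sym (*-identityˡ _))

  ∑-preimage : ∀ (h : Fin m → ℕ) → ∑[ x < n ] h (φ x) ≡ ∑[ y < m ] h y + 3 * h v*
  ∑-preimage h = begin
    ∑[ x < n ] h (φ x)                              ≡⟨ ∑-fibres φ h ⟩
    ∑[ y < m ] (h y * ∑[ x < n ] δ (φ x) y)         ≡⟨ sum-cong-≗ (λ y → cong (h y *_) (fibre-size y)) ⟩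
    ∑[ y < m ] (h y * (1 + 3 * δ v* y))             ≡⟨ sum-cong-≗ (λ y → distribute (h y) (δ v* y)) ⟩
    ∑[ y < m ] (h y + 3 * h y * δ v* y)             ≡⟨ ∑-distrib-+ h (λ y → 3 * h y * δ v* y) ⟩
    ∑[ y < m ] h y + ∑[ y < m ] (3 * h y * δ v* y)  ≡⟨ cong (∑[ y < m ] h y +_) (∑-δ (λ y → 3 * h y) v*) ⟩
    ∑[ y < m ] h y + 3 * h v*                       ∎
    where
    open ≡-Reasoning
    distribute : ∀ a d → a * (1 + 3 * d) ≡ a + 3 * a * d
    distribute = solve-∀

  vertex-count : n ≡ m + 3
  vertex-count = trans (sym (∑-one n)) (trans (∑-preimage (λ _ → 1)) (cong (_+ 3) (∑-one m)))

  preimage : Subset m → Subset n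
  preimage S' = tabulate (λ x → lookup S' (φ x))

  ∈-preimage : ∀ {S' x} → φ x Subset.∈ S' → x Subset.∈ preimage S'
  ∈-preimage {S'} {x} φx∈S' = lookup⇒[]= x (preimage S') (trans (lookup∘tabulate (λ x → lookup S' (φ x)) x) ([]=⇒lookup φx∈S'))

  ∣preimage∣ : ∀ S' → ∣ preimage S' ∣ ≡ ∣ S' ∣ + 3 * 𝟙 (lookup S' v*)
  ∣preimage∣ S' = begin
    ∣ preimage S' ∣                                      ≡⟨ ∣∣≡∑ (preimage S') ⟩
    ∑[ x < n ] 𝟙 (lookup (preimage S') x)                ≡⟨ sum-cong-≗ (λ x → cong 𝟙 (lookup∘tabulate (λ x → lookup S' (φ x)) x)) ⟩
    ∑[ x < n ] 𝟙 (lookup S' (φ x))                       ≡⟨ ∑-preimage (λ y → 𝟙 (lookup S' y)) ⟩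
    ∑[ y < m ] 𝟙 (lookup S' y) + 3 * 𝟙 (lookup S' v*)    ≡⟨ cong (_+ 3 * 𝟙 (lookup S' v*)) (sym (∣∣≡∑ S')) ⟩
    ∣ S' ∣ + 3 * 𝟙 (lookup S' v*)                        ∎
    where open ≡-Reasoning

-- Counting edges: a K4 in a simple graph spans exactly six edges

InsideK? : ∀ {n} (k : Fin 4 → Fin n) (e : Fin n × Fin n) → Dec (InK k (proj₁ e) × InK k (proj₂ e))
InsideK? k e = InK? k (proj₁ e) ×-dec InK? k (proj₂ e)

module K4Edges {n} (G : Graph n) (k : Fin 4 → Fin n) (simple : Simple G) (isK4 : IsK4 G k) where

  edgesK : Graph n
  edgesK = filter (InsideK? k) G

  index : Fin n → Fin 4
  index x with InK? k x
  ... | yes (i , _) = i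
  ... | no _ = 0F

  k-index : ∀ {x} → InK k x → k (index x) ≡ x
  k-index {x} x∈K with InK? k x
  ... | yes (_ , ki≡x) = ki≡x
  ... | no x∉K = ⊥-elim (x∉K x∈K)

  index-k : ∀ i → index (k i) ≡ i
  index-k i = proj₁ isK4 (k-index (i , refl))

  code : Fin n × Fin n → Fin 6
  code e = pairIndex (index (proj₁ e)) (index (proj₂ e))

  ∈-edgesK : ∀ {u v} → (u , v) ∈ edgesK → (InK k u × InK k v) × u ≢ v
  ∈-edgesK e∈ = let (e∈G , inside) = ∈-filter⁻ (InsideK? k) {xs = G} e∈
                in inside , All.lookup (proj₁ simple) e∈G

  distinct-indices : ∀ {u v} → (u , v) ∈ edgesK → index u ≢ index v
  distinct-indices e∈ same-index =
    let ((u∈K , v∈K) , u≢v) = ∈-edgesK e∈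
    in u≢v (trans (sym (k-index u∈K)) (trans (cong k same-index) (k-index v∈K)))

  code-separates : ∀ {e e'} → e ∈ edgesK → e' ∈ edgesK → code e ≡ code e' → SameEnds e e'
  code-separates {u , v} {u' , v'} e∈ e'∈ same-code =
    SameEnds-map k (k-index u∈K) (k-index v∈K) (k-index u'∈K) (k-index v'∈K)
      (SameEnds-trans (pair-pairIndex _ _ (distinct-indices e∈))
        (subst (λ c → SameEnds (pair c) _) (sym same-code)
               (SameEnds-sym (pair-pairIndex _ _ (distinct-indices e'∈)))))
    where
    u∈K = proj₁ (proj₁ (∈-edgesK e∈))
    v∈K = proj₂ (proj₁ (∈-edgesK e∈))
    u'∈K = proj₁ (proj₁ (∈-edgesK e'∈))
    v'∈K = proj₂ (proj₁ (∈-edgesK e'∈))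

  code-attained : ∀ c → ∃ λ e → e ∈ edgesK × code e ≡ c
  code-attained c with proj₂ isK4 (proj₁ (pair c)) (proj₂ (pair c)) (pair-distinct c)
  ... | inj₁ e∈G = _ , ∈-filter⁺ (InsideK? k) e∈G ((_ , refl) , (_ , refl)) ,
                   trans (cong₂ pairIndex (index-k _) (index-k _)) (pairIndex-pair c (inj₁ (refl , refl)))
  ... | inj₂ e∈G = _ , ∈-filter⁺ (InsideK? k) e∈G ((_ , refl) , (_ , refl)) ,
                   trans (cong₂ pairIndex (index-k _) (index-k _)) (pairIndex-pair c (inj₂ (refl , refl)))

  -- codes are a bijection between edges inside K and 2-subsets of Fin 4
  six-edges : length edgesK ≡ 6
  six-edges = ≤-antisym
    (length≤-by-code code (λ e∈ e'∈ same-code distinct → distinct (code-separates e∈ e'∈ same-code))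
                     (AllPairsP.filter⁺ (InsideK? k) (proj₂ simple)))
    (length≥-by-code code code-attained)

-- the sparsity inequality transfers between subgraphs with equal f-value
sparsity-transfer : ∀ {ℓ a b s t} → a + 2 * t ≡ b + 2 * s → b + ℓ ≤ 2 * t → a + ℓ ≤ 2 * s
sparsity-transfer {ℓ} {a} {b} {s} {t} same-f b+ℓ≤2t = +-cancelˡ-≤ b (a + ℓ) (2 * s) (begin
  b + (a + ℓ)  ≡⟨ swap b a ℓ ⟩
  a + (b + ℓ)  ≤⟨ +-monoʳ-≤ a b+ℓ≤2t ⟩
  a + 2 * t    ≡⟨ same-f ⟩
  b + 2 * s    ∎)
  where
  open ≤-Reasoning
  swap : ∀ b a ℓ → b + (a + ℓ) ≡ a + (b + ℓ)
  swap = solve-∀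

-- deleting six edges and three vertices leaves f unchanged
count-transfer : ∀ {ℓ c e n m} → c + 6 ≡ e → e + ℓ ≡ 2 * n → n ≡ m + 3 → c + ℓ ≡ 2 * m
count-transfer {ℓ} {c} {m = m} refl f≡ℓ refl = +-cancelʳ-≡ 6 (c + ℓ) (2 * m) (begin
  (c + ℓ) + 6    ≡⟨ reorder c ℓ ⟩
  (c + 6) + ℓ    ≡⟨ f≡ℓ ⟩
  2 * (m + 3)    ≡⟨ expand m ⟩
  2 * m + 6      ∎)
  where
  open ≡-Reasoning
  reorder : ∀ c ℓ → (c + ℓ) + 6 ≡ (c + 6) + ℓ
  reorder = solve-∀
  expand : ∀ m → 2 * (m + 3) ≡ 2 * m + 6
  expand = solve-∀

-- a lifted subgraph with six more edges on three more vertices has the same f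
add-K-f : ∀ a s → a + 2 * (s + 3 * 1) ≡ (a + 6) + 2 * s
add-K-f = solve-∀

-- The contraction G/K

module Contraction {n m} (G : Graph n) (k : Fin 4 → Fin n) (φ : Fin n → Fin m)
  (simple : Simple G) (isK4 : IsK4 G k) (quotient : IsK4Quotient k φ)
  (no-triangle : ¬ TriangleMeetingK2 G k) where

  open VertexCount k φ (proj₁ isK4) quotient
  open K4Edges G k simple isK4

  outerEdges : Graph n
  outerEdges = filter (NotKEdge? k) G

  contractEdge : Fin n × Fin n → Fin m × Fin m
  contractEdge e = φ (proj₁ e) , φ (proj₂ e)

  edge-count : length outerEdges + 6 ≡ length G
  edge-count = trans (cong (length outerEdges +_) (sym six-edges)) (length-filter-split (InsideK? k) G)

  K-adjacent : ∀ {x y} → InK k x → InK k y → x ≢ y → Adj G x y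
  K-adjacent (i , refl) (j , refl) ki≢kj = proj₂ isK4 i j (λ i≡j → ki≢kj (cong k i≡j))

  -- a vertex outside K has at most one neighbour in K, since two would span
  -- a triangle meeting K in two vertices
  unique-K-neighbour : ∀ {x y z} → ¬ InK k z → InK k x → InK k y → Adj G x z → Adj G y z → x ≡ y
  unique-K-neighbour {x} {y} {z} z∉K x∈K y∈K xz yz with x ≟ y
  ... | yes x≡y = x≡y
  ... | no x≢y = ⊥-elim (no-triangle (x , y , z , x∈K , y∈K , z∉K , x≢y , K-adjacent x∈K y∈K x≢y , xz , yz))

  outer-edge-injective : ∀ {u v a b} → Adj G u v → Adj G a b →
    ¬ (InK k u × InK k v) → ¬ (InK k a × InK k b) → φ u ≡ φ a → φ v ≡ φ b → u ≡ a × v ≡ b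
  outer-edge-injective uv ab uv-outer ab-outer φu≡φa φv≡φb with φ-identifies φu≡φa | φ-identifies φv≡φb
  ... | inj₁ u≡a | inj₁ v≡b = u≡a , v≡b
  ... | inj₁ refl | inj₂ (v∈K , b∈K) =
    refl , unique-K-neighbour (λ u∈K → uv-outer (u∈K , v∈K)) v∈K b∈K (Adj-sym uv) (Adj-sym ab)
  ... | inj₂ (u∈K , a∈K) | inj₁ refl =
    unique-K-neighbour (λ v∈K → uv-outer (u∈K , v∈K)) u∈K a∈K uv ab , refl
  ... | inj₂ (u∈K , _) | inj₂ (v∈K , _) = ⊥-elim (uv-outer (u∈K , v∈K))

  Outer : Fin n × Fin n → Set
  Outer (u , v) = Adj G u v × ¬ (InK k u × InK k v) × u ≢ v

  outer : All Outer outerEdges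
  outer = All.tabulate λ e∈ → let (e∈G , not-inside) = ∈-filter⁻ (NotKEdge? k) {xs = G} e∈
                              in inj₁ e∈G , not-inside , All.lookup (proj₁ simple) e∈G

  no-loop : ∀ {u v} → Outer (u , v) → φ u ≢ φ v
  no-loop (_ , not-inside , u≢v) φu≡φv with φ-identifies φu≡φv
  ... | inj₁ u≡v = u≢v u≡v
  ... | inj₂ inside = not-inside inside

  no-parallel : ∀ {u v a b} → Outer (u , v) → Outer (a , b) →
    ¬ SameEnds (u , v) (a , b) → ¬ SameEnds (φ u , φ v) (φ a , φ b)
  no-parallel (uv , uv-outer , _) (ab , ab-outer , _) distinct (inj₁ (φu≡φa , φv≡φb))
    with outer-edge-injective uv ab uv-outer ab-outer φu≡φa φv≡φb
  ... | refl , refl = distinct (inj₁ (refl , refl))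
  no-parallel (uv , uv-outer , _) (ab , ab-outer , _) distinct (inj₂ (φu≡φb , φv≡φa))
    with outer-edge-injective uv (Adj-sym ab) uv-outer (λ (b∈K , a∈K) → ab-outer (a∈K , b∈K)) φu≡φb φv≡φa
  ... | refl , refl = distinct (inj₂ (refl , refl))

  contracted-simple : Simple (contractK4 G k φ)
  contracted-simple =
    AllP.map⁺ (All.map no-loop outer) ,
    AllPairsP.map⁺ (AllPairs-mapWith no-parallel outer (AllPairsP.filter⁺ (NotKEdge? k) (proj₂ simple)))

  edgesK-in-preimage : ∀ S' → lookup S' v* ≡ true → All (EdgeIn (preimage S')) edgesK
  edgesK-in-preimage S' v*∈S' = All.tabulate λ e∈ → let ((u∈K , v∈K) , _) = ∈-edgesK e∈ in
    ∈-preimage (K-in-S' u∈K) , ∈-preimage (K-in-S' v∈K)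
    where
    K-in-S' : ∀ {x} → InK k x → φ x Subset.∈ S'
    K-in-S' {x} x∈K = lookup⇒[]= (φ x) S' (trans (cong (lookup S') (φ-on-K x∈K)) v*∈S')

  lift-edges : ∀ S' {F₀} → F₀ ⊆ outerEdges → All (EdgeIn (preimage S')) F₀ → F₀ ≢ [] →
    ∀ b → lookup S' v* ≡ b →
    ∃ λ F → F ⊆ G × All (EdgeIn (preimage S')) F × F ≢ [] ×
            length F₀ + 2 * ∣ preimage S' ∣ ≡ length F + 2 * ∣ S' ∣
  lift-edges S' {F₀} F₀⊆ F₀-in F₀≢[] false v*∉S' =
    F₀ , ⊆-trans F₀⊆ (filter-⊆ (NotKEdge? k) G) , F₀-in , F₀≢[] ,
    cong (λ s → length F₀ + 2 * s)
         (trans (∣preimage∣ S') (trans (cong (λ b → ∣ S' ∣ + 3 * 𝟙 b) v*∉S') (+-identityʳ _)))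
  lift-edges S' {F₀} F₀⊆ F₀-in F₀≢[] true v*∈S'
    with ⊆-union-filter (InsideK? k) G F₀⊆ F₀-in (edgesK-in-preimage S' v*∈S')
  ... | F₁ , F₁⊆G , len , F₁-in = F₁ , F₁⊆G , F₁-in , F₁≢[] , same-f
    where
    open ≡-Reasoning
    len-F₁ : length F₁ ≡ length F₀ + 6
    len-F₁ = trans len (cong (length F₀ +_) six-edges)
    F₁≢[] : F₁ ≢ []
    F₁≢[] refl = 0≢1+n (trans len-F₁ (+-suc (length F₀) 5))
    same-f : length F₀ + 2 * ∣ preimage S' ∣ ≡ length F₁ + 2 * ∣ S' ∣
    same-f = begin
      length F₀ + 2 * ∣ preimage S' ∣      ≡⟨ cong (λ s → length F₀ + 2 * s) (∣preimage∣ S') ⟩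
      length F₀ + 2 * (∣ S' ∣ + 3 * 𝟙 (lookup S' v*)) ≡⟨ cong (λ b → length F₀ + 2 * (∣ S' ∣ + 3 * 𝟙 b)) v*∈S' ⟩
      length F₀ + 2 * (∣ S' ∣ + 3 * 1)     ≡⟨ add-K-f (length F₀) ∣ S' ∣ ⟩
      (length F₀ + 6) + 2 * ∣ S' ∣         ≡⟨ cong (_+ 2 * ∣ S' ∣) (sym len-F₁) ⟩
      length F₁ + 2 * ∣ S' ∣               ∎

  -- a subgraph of G/K violating sparsity would lift to one of G
  contracted-sparse : ∀ {ℓ} → Sparse ℓ G → Sparse ℓ (contractK4 G k φ)
  contracted-sparse sparse S' F' F'⊆ F'-in F'≢[] with ⊆-map⁻ contractEdge outerEdges F'⊆
  ... | F₀ , F₀⊆ , refl with lift-edges S' F₀⊆ F₀-in (λ { refl → F'≢[] refl }) (lookup S' v*) refl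
    where
    F₀-in : All (EdgeIn (preimage S')) F₀
    F₀-in = All.map (λ (φu∈ , φv∈) → ∈-preimage φu∈ , ∈-preimage φv∈) (AllP.map⁻ F'-in)
  ... | F , F⊆G , F-in , F≢[] , same-f =
    sparsity-transfer {b = length F} {s = ∣ S' ∣} {t = ∣ preimage S' ∣}
                      (trans (cong (_+ _) (length-map contractEdge F₀)) same-f)
                      (sparse (preimage S') F F⊆G F-in F≢[])

  contracted-count : ∀ {ℓ} → length G + ℓ ≡ 2 * n → length (contractK4 G k φ) + ℓ ≡ 2 * m
  contracted-count G-count =
    trans (cong (_+ _) (length-map contractEdge outerEdges)) (count-transfer edge-count G-count vertex-count)

lemma3p3 : (ℓ : ℕ) → 1 ≤ ℓ → ℓ ≤ 3 →
    (n : ℕ) (G : Graph n) → Simple G → Tight ℓ G → 4 < n →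
    (k : Fin 4 → Fin n) → IsK4 G k →
    (m : ℕ) (φ : Fin n → Fin m) → IsK4Quotient k φ →
    ¬ TriangleMeetingK2 G k →
    Simple (contractK4 G k φ) × Tight ℓ (contractK4 G k φ)
lemma3p3 ℓ _ _ n G simple (sparse , count) _ k isK4 m φ quotient no-triangle =
  contracted-simple , contracted-sparse sparse , contracted-count count
  where open Contraction G k φ simple isK4 quotient no-triangle
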